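{- Let $R$ be an orthogonal TRS having a binary symbol $:$ (written infix) in its signature. If $t\to^* u:t_u$, then there are terms $u',t_u'$ such that $t$ rewrites to $u':t_u'$ by a sequence of outermost steps and $u':t_u'\to^* u:t_u$.
   Context: A rewrite step $t\to_p t'$ contracting a redex at position $p$ is outermost if $t$ has no redex at a position that is a proper prefix of $p$. -}

module Defs where

open import Data.Nat using (ℕ; zero; suc; _+_; _≤_; _<_)
open import Data.List using (List; []; _∷_; _++_)
open import Data.Vec using (Vec; []; _∷_)
open import Data.Maybe using (Maybe; just; nothing)
open import Data.Product using (Σ; ∃; ∃-syntax; _×_; _,_)
open import Data.Empty using (⊥)
open import Data.Unit using (⊤)
open import Relation.Nullary using (¬_)
open import Relation.Binary.PropositionalEquality using (_≡_)

data Term (F : ℕ → Set) : Set where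
  var : ℕ → Term F
  fun : {n : ℕ} → F n → Vec (Term F) n → Term F

-- Positions: sequences of argument indices (0-based).
Pos : Set
Pos = List ℕ

Rules : (F : ℕ → Set) → Set₁
Rules F = Term F → Term F → Set

module _ {F : ℕ → Set} where

  Subst : Set
  Subst = ℕ → Term F

  mutual
    _⟨_⟩ : Term F → Subst → Term F
    var x ⟨ σ ⟩ = σ x
    fun f ts ⟨ σ ⟩ = fun f (substArgs ts σ)

    substArgs : {n : ℕ} → Vec (Term F) n → Subst → Vec (Term F) n
    substArgs [] σ = []
    substArgs (t ∷ ts) σ = (t ⟨ σ ⟩) ∷ substArgs ts σ

  mutual
    _at_ : Term F → Pos → Maybe (Term F)
    t at [] = just t
    var x at (i ∷ p) = nothing
    fun f ts at (i ∷ p) = atArgs ts i p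

    atArgs : {n : ℕ} → Vec (Term F) n → ℕ → Pos → Maybe (Term F)
    atArgs [] i p = nothing
    atArgs (t ∷ ts) zero p = t at p
    atArgs (t ∷ ts) (suc i) p = atArgs ts i p

  -- replacement t[s]_p (identity if p is not a position of t)
  mutual
    replace : Term F → Pos → Term F → Term F
    replace t [] s = s
    replace (var x) (i ∷ p) s = var x
    replace (fun f ts) (i ∷ p) s = fun f (replaceArgs ts i p s)

    replaceArgs : {n : ℕ} → Vec (Term F) n → ℕ → Pos → Term F → Vec (Term F) n
    replaceArgs [] i p s = []
    replaceArgs (t ∷ ts) zero p s = replace t p s ∷ ts
    replaceArgs (t ∷ ts) (suc i) p s = t ∷ replaceArgs ts i p s

  mutual
    occ : ℕ → Term F → ℕ
    occ x (var y) with x Data.Nat.≟ y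
    ... | Relation.Nullary.yes _ = 1
    ... | Relation.Nullary.no _ = 0
    occ x (fun f ts) = occArgs x ts

    occArgs : {n : ℕ} → ℕ → Vec (Term F) n → ℕ
    occArgs x [] = 0
    occArgs x (t ∷ ts) = occ x t + occArgs x ts

  IsFun : Term F → Set
  IsFun (var x) = ⊥
  IsFun (fun f ts) = ⊤

  record IsTRS (R : Rules F) : Set where
    field
      lhs-nonvar : ∀ {l r} → R l r → IsFun l
      rhs-vars   : ∀ {l r} x → R l r → 0 < occ x r → 0 < occ x l

  LeftLinear : Rules F → Set
  LeftLinear R = ∀ {l r} → R l r → ∀ x → occ x l ≤ 1

  -- non-overlapping: if a non-variable subterm l₁|p of a lhs unifies with
  -- a lhs l₂ (variables of the two rules renamed apart, i.e. independent
  -- substitutions σ, τ), then p is the root position and the two rules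
  -- are the same rule.
  NonOverlapping : Rules F → Set
  NonOverlapping R =
    ∀ {l₁ r₁ l₂ r₂} → R l₁ r₁ → R l₂ r₂ →
    ∀ (p : Pos) (s : Term F) (σ τ : Subst) →
    l₁ at p ≡ just s → IsFun s → s ⟨ σ ⟩ ≡ l₂ ⟨ τ ⟩ →
    (p ≡ []) × (l₁ ≡ l₂) × (r₁ ≡ r₂)

  Orthogonal : Rules F → Set
  Orthogonal R = LeftLinear R × NonOverlapping R

  RedexAt : Rules F → Term F → Pos → Set
  RedexAt R t p = ∃[ l ] ∃[ r ] ∃[ σ ] (R l r × (t at p ≡ just (l ⟨ σ ⟩)))

  StepAt : Rules F → Term F → Pos → Term F → Set
  StepAt R t p t' =
    ∃[ l ] ∃[ r ] ∃[ σ ]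
      (R l r × (t at p ≡ just (l ⟨ σ ⟩)) × (t' ≡ replace t p (r ⟨ σ ⟩)))

  Step : Rules F → Term F → Term F → Set
  Step R t t' = ∃[ p ] StepAt R t p t'

  ProperPrefix : Pos → Pos → Set
  ProperPrefix q p = ∃[ i ] ∃[ k ] (q ++ (i ∷ k) ≡ p)

  OutermostStep : Rules F → Term F → Term F → Set
  OutermostStep R t t' =
    ∃[ p ] (StepAt R t p t' × (∀ q → ProperPrefix q p → ¬ RedexAt R t q))

  -- the binary infix symbol  :  applied to two terms
  cons : F 2 → Term F → Term F → Term F
  cons c u v = fun c (u ∷ v ∷ [])

-- Each rewrite step is a nested parallel multistep ⇉.  The key commutation is: if
-- t ⇉ t₁ and t₁ → t₂ is outermost, then t reaches by outermost steps some t₀ ⇉ t₂.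
-- Orthogonality enters twice.  A redex at the root survives any multistep that does
-- not contract it (left-linearity lets the pieces of its matcher be merged, and
-- non-overlap forbids contracting a redex inside its pattern).  Conversely, if
-- t ⇉ l σ₁ for a left-hand side l, then t reaches some l σ₀ ⇉ l σ₁ by outermost steps
-- at non-variable positions of l.  Iterating, every reduction t →* s splits into
-- outermost steps followed by steps below the root; the latter keep the root symbol,
-- so the term in between already has the shape u' : tu'.
module Submission where

open import Defs
open import Data.Nat using (ℕ; zero; suc; _+_; _≤_; _<_; z≤n; s≤s; s≤s⁻¹; _≟_)
open import Data.Nat.Properties using (≤-refl; ≤-trans; m≤m+n; m≤n+m; m+n≤o⇒n≤o; <⇒≱)
open import Data.List using ([]; _∷_; _++_)
open import Data.Vec using (Vec; []; _∷_)
open import Data.Vec.Properties using (∷-injectiveˡ; ∷-injectiveʳ)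
open import Data.Vec.Relation.Unary.All using (All; []; _∷_)
open import Data.Vec.Relation.Binary.Pointwise.Inductive using (Pointwise; []; _∷_)
open import Data.Maybe using (just)
open import Data.Maybe.Properties using (just-injective)
open import Data.Product using (Σ; ∃-syntax; _×_; _,_; proj₁)
open import Data.Sum using (_⊎_; inj₁; inj₂)
open import Data.Empty using (⊥-elim)
open import Data.Unit using (tt)
open import Relation.Nullary using (¬_; yes; no)
open import Relation.Binary.PropositionalEquality using (_≡_; refl; sym; trans; cong; cong₂; subst)
open import Relation.Binary.Construct.Closure.ReflexiveTransitive using (Star; ε; _◅_; _◅◅_; gmap; map)

module _ {F : ℕ → Set} where

  private
    Sub : Set
    Sub = Subst {F}

  fun-injective : ∀ {m n} {f : F m} {g : F n} {ts us} → _≡_ {A = Term F} (fun f ts) (fun g us) →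
                  Σ (m ≡ n) λ { refl → f ≡ g × ts ≡ us }
  fun-injective refl = refl , refl , refl

  mutual
    at-++ : ∀ (t : Term F) o {s} q → t at o ≡ just s → t at (o ++ q) ≡ s at q
    at-++ t          []      q refl = refl
    at-++ (var x)    (i ∷ o) q ()
    at-++ (fun f ts) (i ∷ o) q h    = atArgs-++ ts i o q h

    atArgs-++ : ∀ {n} (ts : Vec (Term F) n) i o {s} q →
                atArgs ts i o ≡ just s → atArgs ts i (o ++ q) ≡ s at q
    atArgs-++ []       i       o q ()
    atArgs-++ (t ∷ ts) zero    o q h = at-++ t o q h
    atArgs-++ (t ∷ ts) (suc i) o q h = atArgs-++ ts i o q h

  mutual
    at-⟨⟩ : ∀ (t : Term F) p {s} (ρ : Sub) → t at p ≡ just s → (t ⟨ ρ ⟩) at p ≡ just (s ⟨ ρ ⟩)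
    at-⟨⟩ t          []      ρ refl = refl
    at-⟨⟩ (var x)    (i ∷ p) ρ ()
    at-⟨⟩ (fun f ts) (i ∷ p) ρ h    = atArgs-⟨⟩ ts i p ρ h

    atArgs-⟨⟩ : ∀ {n} (ts : Vec (Term F) n) i p {s} (ρ : Sub) →
                atArgs ts i p ≡ just s → atArgs (substArgs ts ρ) i p ≡ just (s ⟨ ρ ⟩)
    atArgs-⟨⟩ []       i       p ρ ()
    atArgs-⟨⟩ (t ∷ ts) zero    p ρ h = at-⟨⟩ t p ρ h
    atArgs-⟨⟩ (t ∷ ts) (suc i) p ρ h = atArgs-⟨⟩ ts i p ρ h

  mutual
    occ-at : ∀ x (t : Term F) o {s} → t at o ≡ just s → occ x s ≤ occ x t
    occ-at x t          []      refl = ≤-refl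
    occ-at x (var y)    (i ∷ o) ()
    occ-at x (fun f ts) (i ∷ o) h    = occ-atArgs x ts i o h

    occ-atArgs : ∀ x {n} (ts : Vec (Term F) n) i o {s} → atArgs ts i o ≡ just s → occ x s ≤ occArgs x ts
    occ-atArgs x []       i       o ()
    occ-atArgs x (t ∷ ts) zero    o h = ≤-trans (occ-at x t o h) (m≤m+n _ _)
    occ-atArgs x (t ∷ ts) (suc i) o h = ≤-trans (occ-atArgs x ts i o h) (m≤n+m _ _)

  occ-var-self : ∀ y → 0 < occ y (var {F} y)
  occ-var-self y with y ≟ y
  ... | yes _ = s≤s z≤n
  ... | no y≢y = ⊥-elim (y≢y refl)

  mutual
    ⟨⟩-agree : ∀ (t : Term F) {σ τ : Sub} → (∀ x → 0 < occ x t → σ x ≡ τ x) → t ⟨ σ ⟩ ≡ t ⟨ τ ⟩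
    ⟨⟩-agree (var y)    h = h y (occ-var-self y)
    ⟨⟩-agree (fun f ts) h = cong (fun f) (substArgs-agree ts h)

    substArgs-agree : ∀ {n} (ts : Vec (Term F) n) {σ τ : Sub} →
                      (∀ x → 0 < occArgs x ts → σ x ≡ τ x) → substArgs ts σ ≡ substArgs ts τ
    substArgs-agree []       h = refl
    substArgs-agree (t ∷ ts) h =
      cong₂ _∷_ (⟨⟩-agree t (λ x o → h x (≤-trans o (m≤m+n _ _))))
                (substArgs-agree ts (λ x o → h x (≤-trans o (m≤n+m _ _))))

  substEach : ∀ {n} → Vec (Term F) n → Vec Sub n → Vec (Term F) n
  substEach []       []       = []
  substEach (P ∷ Ps) (ρ ∷ ρs) = (P ⟨ ρ ⟩) ∷ substEach Ps ρs

  merge : ∀ {n} → Vec (Term F) n → Vec Sub n → Sub → Sub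
  merge []       []       d x = d x
  merge (P ∷ Ps) (ρ ∷ ρs) d x with occ x P
  ... | zero  = merge Ps ρs d x
  ... | suc _ = ρ x

  merge-here : ∀ {n} P (Ps : Vec (Term F) n) ρ ρs d x → 0 < occ x P → merge (P ∷ Ps) (ρ ∷ ρs) d x ≡ ρ x
  merge-here P Ps ρ ρs d x x∈P with occ x P
  merge-here P Ps ρ ρs d x () | zero
  ... | suc _ = refl

  merge-there : ∀ {n} P (Ps : Vec (Term F) n) ρ ρs d x → occ x P + occArgs x Ps ≤ 1 → 0 < occArgs x Ps →
                merge (P ∷ Ps) (ρ ∷ ρs) d x ≡ merge Ps ρs d x
  merge-there P Ps ρ ρs d x linear x∈Ps with occ x P
  ... | zero  = refl
  ... | suc k = ⊥-elim (<⇒≱ x∈Ps (m+n≤o⇒n≤o k (s≤s⁻¹ linear)))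

  merge-correct : ∀ {n} (Ps : Vec (Term F) n) ρs d → (∀ x → occArgs x Ps ≤ 1) →
                  substArgs Ps (merge Ps ρs d) ≡ substEach Ps ρs
  merge-correct []       []       d linear = refl
  merge-correct (P ∷ Ps) (ρ ∷ ρs) d linear =
    cong₂ _∷_ (⟨⟩-agree P (merge-here P Ps ρ ρs d))
              (trans (substArgs-agree Ps (λ x → merge-there P Ps ρ ρs d x (linear x)))
                     (merge-correct Ps ρs d (λ x → ≤-trans (m≤n+m _ _) (linear x))))

  merge-preserves : ∀ {n} (Q : ℕ → Term F → Set) (Ps : Vec (Term F) n) ρs d → (∀ x → Q x (d x)) →
                    All (λ ρ → ∀ x → Q x (ρ x)) ρs → ∀ x → Q x (merge Ps ρs d x)
  merge-preserves Q []       []       d Qd []         x = Qd x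
  merge-preserves Q (P ∷ Ps) (ρ ∷ ρs) d Qd (Qρ ∷ Qρs) x with occ x P
  ... | zero  = merge-preserves Q Ps ρs d Qd Qρs x
  ... | suc _ = Qρ x

  _[_↦_] : Sub → ℕ → Term F → Sub
  (σ [ y ↦ t ]) x with x ≟ y
  ... | yes _ = t
  ... | no _  = σ x

  ↦-self : ∀ σ y t → (σ [ y ↦ t ]) y ≡ t
  ↦-self σ y t with y ≟ y
  ... | yes _ = refl
  ... | no y≢y = ⊥-elim (y≢y refl)

  all-args : ∀ {n} (Q : Term F → Set) (Ps : Vec (Term F) n) → (∀ k {P} → atArgs Ps k [] ≡ just P → Q P) → All Q Ps
  all-args Q []       h = []
  all-args Q (P ∷ Ps) h = h 0 refl ∷ all-args Q Ps (λ k → h (suc k))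

  ¬properPrefix-[] : ∀ {q} → ¬ ProperPrefix {F} q []
  ¬properPrefix-[] {[]}    (i , k , ())
  ¬properPrefix-[] {x ∷ q} (i , k , ())

  properPrefix-[] : ∀ {i p} → ProperPrefix {F} [] (i ∷ p)
  properPrefix-[] {i} {p} = i , p , refl

  properPrefix-∷ : ∀ {q p i} → ProperPrefix {F} q p → ProperPrefix {F} (i ∷ q) (i ∷ p)
  properPrefix-∷ {i = i} (j , k , e) = j , k , cong (i ∷_) e

  properPrefix-∷⁻ : ∀ {q i p} → ProperPrefix {F} q (i ∷ p) →
                    q ≡ [] ⊎ ∃[ q' ] (q ≡ i ∷ q' × ProperPrefix {F} q' p)
  properPrefix-∷⁻ {[]}     _             = inj₁ refl
  properPrefix-∷⁻ {j ∷ q'} (k , m , refl) = inj₂ (q' , refl , (k , m , refl))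

module Reordering {F : ℕ → Set} (R : Rules F) (left-linear : LeftLinear R)
                  (non-overlapping : NonOverlapping R) where

  private
    Tm : Set
    Tm = Term F
    Sub : Set
    Sub = Subst {F}

  RedexAtArgs : ∀ {n} → Vec Tm n → ℕ → Pos → Set
  RedexAtArgs ts i p = ∃[ l ] ∃[ r ] ∃[ σ ] (R l r × atArgs ts i p ≡ just (l ⟨ σ ⟩))

  StepAtArgs : ∀ {n} → Vec Tm n → ℕ → Pos → Vec Tm n → Set
  StepAtArgs ts i p ts' = ∃[ l ] ∃[ r ] ∃[ σ ]
    (R l r × atArgs ts i p ≡ just (l ⟨ σ ⟩) × ts' ≡ replaceArgs ts i p (r ⟨ σ ⟩))

  NoRedexAbove : Tm → Pos → Set
  NoRedexAbove t p = ∀ q → ProperPrefix {F} q p → ¬ RedexAt R t q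

  NoRedexAboveArgs : ∀ {n} → Vec Tm n → ℕ → Pos → Set
  NoRedexAboveArgs ts i p = ∀ q → ProperPrefix {F} q p → ¬ RedexAtArgs ts i q

  NonRootStep : Tm → Tm → Set
  NonRootStep t t' = ∃[ i ] ∃[ p ] StepAt R t (i ∷ p) t'

  ArgsStep : ∀ {n} → Vec Tm n → Vec Tm n → Set
  ArgsStep ts ts' = ∃[ i ] ∃[ p ] StepAtArgs ts i p ts'

  ArgsOutermostStep : ∀ {n} → Vec Tm n → Vec Tm n → Set
  ArgsOutermostStep ts ts' = ∃[ i ] ∃[ p ] (StepAtArgs ts i p ts' × NoRedexAboveArgs ts i p)

  stepAt-fun : ∀ {n} (f : F n) {ts ts' i p} → StepAtArgs ts i p ts' → StepAt R (fun f ts) (i ∷ p) (fun f ts')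
  stepAt-fun f (l , r , σ , lr , at≡ , eq) = l , r , σ , lr , at≡ , cong (fun f) eq

  stepAtArgs-here : ∀ {n t t' p} {ts : Vec Tm n} → StepAt R t p t' → StepAtArgs (t ∷ ts) 0 p (t' ∷ ts)
  stepAtArgs-here {ts = ts} (l , r , σ , lr , at≡ , eq) = l , r , σ , lr , at≡ , cong (_∷ ts) eq

  stepAtArgs-there : ∀ {n t i p} {ts ts' : Vec Tm n} → StepAtArgs ts i p ts' → StepAtArgs (t ∷ ts) (suc i) p (t ∷ ts')
  stepAtArgs-there {t = t} (l , r , σ , lr , at≡ , eq) = l , r , σ , lr , at≡ , cong (t ∷_) eq

  root-stepAt : ∀ {l r} (σ : Sub) → R l r → StepAt R (l ⟨ σ ⟩) [] (r ⟨ σ ⟩)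
  root-stepAt {l} {r} σ lr = l , r , σ , lr , refl , refl

  nonRootStep-fun : ∀ {n} (f : F n) {ts ts'} → ArgsStep ts ts' → NonRootStep (fun f ts) (fun f ts')
  nonRootStep-fun f (i , p , s) = i , p , stepAt-fun f s

  nonRootStep⇒step : ∀ {t t'} → NonRootStep t t' → Step R t t'
  nonRootStep⇒step (i , p , s) = i ∷ p , s

  noRedexAbove-[] : ∀ t → NoRedexAbove t []
  noRedexAbove-[] t q q<[] = ⊥-elim (¬properPrefix-[] {F = F} q<[])

  noRedexAbove-fun : ∀ {n} (f : F n) {ts i p} → NoRedexAboveArgs ts i p → ¬ RedexAt R (fun f ts) [] →
                     NoRedexAbove (fun f ts) (i ∷ p)
  noRedexAbove-fun f noneAbove noneAtRoot q q<ip with properPrefix-∷⁻ {F = F} q<ip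
  ... | inj₁ refl                = noneAtRoot
  ... | inj₂ (q' , refl , q'<p) = noneAbove q' q'<p

  root-outermost : ∀ {l r} (σ : Sub) → R l r → OutermostStep R (l ⟨ σ ⟩) (r ⟨ σ ⟩)
  root-outermost {l} σ lr = [] , root-stepAt σ lr , noRedexAbove-[] (l ⟨ σ ⟩)

  outermost-fun : ∀ {n} (f : F n) {ts ts' i p} → StepAtArgs ts i p ts' → NoRedexAboveArgs ts i p →
                  ¬ RedexAt R (fun f ts) [] → OutermostStep R (fun f ts) (fun f ts')
  outermost-fun f {i = i} {p} s noneAbove noneAtRoot = i ∷ p , stepAt-fun f s , noRedexAbove-fun f noneAbove noneAtRoot

  stepAtArgs⇒redexAtArgs : ∀ {n} {ts ts' : Vec Tm n} {i p} → StepAtArgs ts i p ts' → RedexAtArgs ts i p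
  stepAtArgs⇒redexAtArgs (l , r , σ , lr , at≡ , _) = l , r , σ , lr , at≡

  argsOutermost-here : ∀ {n t t'} {ts : Vec Tm n} → OutermostStep R t t' → ArgsOutermostStep (t ∷ ts) (t' ∷ ts)
  argsOutermost-here (p , s , noneAbove) = 0 , p , stepAtArgs-here s , noneAbove

  argsOutermost-there : ∀ {n t} {ts ts' : Vec Tm n} → ArgsOutermostStep ts ts' → ArgsOutermostStep (t ∷ ts) (t ∷ ts')
  argsOutermost-there (i , p , s , noneAbove) = suc i , p , stepAtArgs-there s , noneAbove

  star-fun : ∀ {n} (f : F n) {ts ts'} → Star ArgsStep ts ts' → Star (Step R) (fun f ts) (fun f ts')
  star-fun f = gmap (fun f) (λ s → nonRootStep⇒step (nonRootStep-fun f s))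

  star-∷ : ∀ {n t u} {ts us : Vec Tm n} → Star (Step R) t u → Star ArgsStep ts us → Star ArgsStep (t ∷ ts) (u ∷ us)
  star-∷ {u = u} {ts} t→u ts→us =
    gmap (_∷ ts) (λ { (p , s) → 0 , p , stepAtArgs-here s }) t→u ◅◅
    gmap (u ∷_) (λ { (i , p , s) → suc i , p , stepAtArgs-there s }) ts→us

  mutual
    star-⟨⟩ : ∀ (r : Tm) {σ σ' : Sub} → (∀ x → Star (Step R) (σ x) (σ' x)) →
              Star (Step R) (r ⟨ σ ⟩) (r ⟨ σ' ⟩)
    star-⟨⟩ (var x)    σ→σ' = σ→σ' x
    star-⟨⟩ (fun f rs) σ→σ' = star-fun f (star-substArgs rs σ→σ')

    star-substArgs : ∀ {n} (rs : Vec Tm n) {σ σ' : Sub} → (∀ x → Star (Step R) (σ x) (σ' x)) →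
                     Star ArgsStep (substArgs rs σ) (substArgs rs σ')
    star-substArgs []       σ→σ' = ε
    star-substArgs (r ∷ rs) σ→σ' = star-∷ (star-⟨⟩ r σ→σ') (star-substArgs rs σ→σ')

  -- Nested parallel multisteps: the redexes contracted at the root may themselves
  -- contain contracted redexes inside their matchers.
  infix 4 _⇉_ _⇉ᵥ_ _⇉ˢ_
  data _⇉_ : Tm → Tm → Set
  data _⇉ᵥ_ : ∀ {n} → Vec Tm n → Vec Tm n → Set

  _⇉ˢ_ : Sub → Sub → Set
  σ ⇉ˢ σ' = ∀ x → σ x ⇉ σ' x

  data _⇉_ where
    ⇉-var  : ∀ x → var x ⇉ var x
    ⇉-fun  : ∀ {n} (f : F n) {ts us} → ts ⇉ᵥ us → fun f ts ⇉ fun f us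
    ⇉-root : ∀ {l r t u} (σ σ' : Sub) → R l r → σ ⇉ˢ σ' → t ≡ l ⟨ σ ⟩ → u ≡ r ⟨ σ' ⟩ → t ⇉ u

  data _⇉ᵥ_ where
    []  : [] ⇉ᵥ []
    _∷_ : ∀ {n t u} {ts us : Vec Tm n} → t ⇉ u → ts ⇉ᵥ us → t ∷ ts ⇉ᵥ u ∷ us

  mutual
    ⇉-refl : ∀ t → t ⇉ t
    ⇉-refl (var x)    = ⇉-var x
    ⇉-refl (fun f ts) = ⇉-fun f (⇉ᵥ-refl ts)

    ⇉ᵥ-refl : ∀ {n} (ts : Vec Tm n) → ts ⇉ᵥ ts
    ⇉ᵥ-refl []       = []
    ⇉ᵥ-refl (t ∷ ts) = ⇉-refl t ∷ ⇉ᵥ-refl ts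

  ⇉ˢ-refl : ∀ σ → σ ⇉ˢ σ
  ⇉ˢ-refl σ x = ⇉-refl (σ x)

  mutual
    ⇉-⟨⟩ : ∀ (r : Tm) {σ σ' : Sub} → σ ⇉ˢ σ' → r ⟨ σ ⟩ ⇉ r ⟨ σ' ⟩
    ⇉-⟨⟩ (var x)    σ⇉σ' = σ⇉σ' x
    ⇉-⟨⟩ (fun f rs) σ⇉σ' = ⇉-fun f (⇉ᵥ-substArgs rs σ⇉σ')

    ⇉ᵥ-substArgs : ∀ {n} (rs : Vec Tm n) {σ σ' : Sub} → σ ⇉ˢ σ' → substArgs rs σ ⇉ᵥ substArgs rs σ'
    ⇉ᵥ-substArgs []       σ⇉σ' = []
    ⇉ᵥ-substArgs (r ∷ rs) σ⇉σ' = ⇉-⟨⟩ r σ⇉σ' ∷ ⇉ᵥ-substArgs rs σ⇉σ'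

  mutual
    stepAt⇒⇉ : ∀ t p {l r σ} → R l r → t at p ≡ just (l ⟨ σ ⟩) → t ⇉ replace t p (r ⟨ σ ⟩)
    stepAt⇒⇉ t          []      {σ = σ} lr at≡ = ⇉-root σ σ lr (⇉ˢ-refl σ) (just-injective at≡) refl
    stepAt⇒⇉ (var x)    (i ∷ p) lr ()
    stepAt⇒⇉ (fun f ts) (i ∷ p) lr at≡ = ⇉-fun f (stepAtArgs⇒⇉ᵥ ts i p lr at≡)

    stepAtArgs⇒⇉ᵥ : ∀ {n} (ts : Vec Tm n) i p {l r σ} → R l r → atArgs ts i p ≡ just (l ⟨ σ ⟩) →
                    ts ⇉ᵥ replaceArgs ts i p (r ⟨ σ ⟩)
    stepAtArgs⇒⇉ᵥ []       i       p lr ()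
    stepAtArgs⇒⇉ᵥ (t ∷ ts) zero    p lr at≡ = stepAt⇒⇉ t p lr at≡ ∷ ⇉ᵥ-refl ts
    stepAtArgs⇒⇉ᵥ (t ∷ ts) (suc i) p lr at≡ = ⇉-refl t ∷ stepAtArgs⇒⇉ᵥ ts i p lr at≡

  step⇒⇉ : ∀ {t t'} → Step R t t' → t ⇉ t'
  step⇒⇉ {t} (p , l , r , σ , lr , at≡ , refl) = stepAt⇒⇉ t p lr at≡

  mutual
    ⇉⇒star : ∀ {t u} → t ⇉ u → Star (Step R) t u
    ⇉⇒star (⇉-var x)                            = ε
    ⇉⇒star (⇉-fun f ts⇉us)                      = star-fun f (⇉ᵥ⇒star ts⇉us)
    ⇉⇒star (⇉-root {r = r} σ σ' lr σ⇉σ' refl refl) =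
      ([] , root-stepAt σ lr) ◅ star-⟨⟩ r (λ x → ⇉⇒star (σ⇉σ' x))

    ⇉ᵥ⇒star : ∀ {n} {ts us : Vec Tm n} → ts ⇉ᵥ us → Star ArgsStep ts us
    ⇉ᵥ⇒star []              = ε
    ⇉ᵥ⇒star (t⇉u ∷ ts⇉us) = star-∷ (⇉⇒star t⇉u) (⇉ᵥ⇒star ts⇉us)

  BelowRoot : Tm → Tm → Set
  BelowRoot l P = ∃[ j ] ∃[ o ] (l at (j ∷ o) ≡ just P)

  belowRoot-args : ∀ {l} j o {n} {g : F n} {Ps} → l at (j ∷ o) ≡ just (fun g Ps) → All (BelowRoot l) Ps
  belowRoot-args {l} j o at≡ = all-args _ _ (λ k atₖ → j , o ++ k ∷ [] , trans (at-++ l (j ∷ o) (k ∷ []) at≡) atₖ)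

  belowRoot-top : ∀ {n} {g : F n} (Ps : Vec Tm n) → All (BelowRoot (fun g Ps)) Ps
  belowRoot-top Ps = all-args _ Ps (λ k atₖ → k , [] , atₖ)

  linear-args : ∀ {l r} → R l r → ∀ o {n} {g : F n} {Ps} → l at o ≡ just (fun g Ps) → ∀ x → occArgs x Ps ≤ 1
  linear-args lr o at≡ x = ≤-trans (occ-at x _ o at≡) (left-linear lr x)

  -- A multistep cannot contract a redex overlapping a left-hand side below its root,
  -- so an instance of a proper subpattern of a left-hand side stays an instance.
  mutual
    pattern-persists : ∀ {l r} → R l r → ∀ P → BelowRoot l P → ∀ (ρ : Sub) {t v} →
                       t ≡ P ⟨ ρ ⟩ → t ⇉ v → ∃[ ρ' ] (v ≡ P ⟨ ρ' ⟩)
    pattern-persists lr (var x)    _ ρ {v = v} _ _ = (λ _ → v) , refl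
    pattern-persists lr (fun g Ps) _ ρ () (⇉-var x)
    pattern-persists {l} lr (fun g Ps) (j , o , at≡) ρ eq (⇉-fun f ts⇉vs) with fun-injective eq
    ... | refl , refl , ts≡ with patterns-persist lr Ps (belowRoot-args {l} j o at≡) ρ ts≡ ts⇉vs
    ... | ρs , vs≡ =
      merge Ps ρs (λ _ → var 0) ,
      cong (fun g) (trans vs≡ (sym (merge-correct Ps ρs _ (linear-args lr (j ∷ o) at≡))))
    pattern-persists lr (fun g Ps) (j , o , at≡) ρ eq (⇉-root σ σ' lr' _ eq₁ _)
      with non-overlapping lr lr' (j ∷ o) (fun g Ps) ρ σ at≡ tt (trans (sym eq) eq₁)
    ... | () , _

    patterns-persist : ∀ {l r} → R l r → ∀ {n} (Ps : Vec Tm n) → All (BelowRoot l) Ps → ∀ (ρ : Sub) {ts vs} →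
                       ts ≡ substArgs Ps ρ → ts ⇉ᵥ vs → ∃[ ρs ] (vs ≡ substEach Ps ρs)
    patterns-persist lr []       []         ρ eq [] = [] , refl
    patterns-persist lr (P ∷ Ps) (P↓ ∷ Ps↓) ρ eq (t⇉v ∷ ts⇉vs)
      with pattern-persists lr P P↓ ρ (∷-injectiveˡ eq) t⇉v
         | patterns-persist lr Ps Ps↓ ρ (∷-injectiveʳ eq) ts⇉vs
    ... | ρ' , v≡ | ρs , vs≡ = ρ' ∷ ρs , cong₂ _∷_ v≡ vs≡

  rootInstance-persists : ∀ {l r} → R l r → ∀ {n} (g : F n) {us vs} (ρ : Sub) → fun g us ≡ l ⟨ ρ ⟩ → us ⇉ᵥ vs →
                          ∃[ ρ' ] (fun g vs ≡ l ⟨ ρ' ⟩)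
  rootInstance-persists {var x}    lr g {vs = vs} _ _ _ = (λ _ → fun g vs) , refl
  rootInstance-persists {fun h Ps} lr g ρ eq us⇉vs with fun-injective eq
  ... | refl , refl , us≡ with patterns-persist lr Ps (belowRoot-top {g = h} Ps) ρ us≡ us⇉vs
  ... | ρs , vs≡ =
    merge Ps ρs (λ _ → var 0) , cong (fun g) (trans vs≡ (sym (merge-correct Ps ρs _ (linear-args lr [] refl))))

  rootRedex-persists : ∀ {n} (g : F n) {us vs} → us ⇉ᵥ vs → RedexAt R (fun g us) [] → RedexAt R (fun g vs) []
  rootRedex-persists g us⇉vs (l , r , ρ , lr , at≡) with rootInstance-persists lr g ρ (just-injective at≡) us⇉vs
  ... | ρ' , eq = l , r , ρ' , lr , cong just eq

  -- A root redex of fun g us would persist to (fun g Ls) σ₁, hence overlap l₀ at o; so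
  -- it is l₀ at o = [], and then the redex of us at i ∷ p overlaps l₀ below its root.
  no-root-redex : ∀ {l₀ r₀} → R l₀ r₀ → ∀ o {n} {g : F n} {Ls} → l₀ at o ≡ just (fun g Ls) → ∀ (σ₁ : Sub) {us} →
                  us ⇉ᵥ substArgs Ls σ₁ → ∀ {i p s} → atArgs Ls i p ≡ just s → IsFun s → RedexAtArgs us i p →
                  ¬ RedexAt R (fun g us) []
  no-root-redex lr₀ o {g = g} {Ls} at≡ σ₁ us⇉ {i} {p} {s} atₛ s-fun (_ , _ , τ , lrᵢ , atᵢ) (_ , _ , ρ , lr , at₀)
    with rootInstance-persists lr g ρ (just-injective at₀) us⇉
  ... | ρ' , eq with non-overlapping lr₀ lr o (fun g Ls) σ₁ ρ' at≡ tt eq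
  ... | refl , refl , _ with just-injective at≡
  ... | refl with fun-injective (just-injective at₀)
  ... | refl , refl , refl with non-overlapping lr lrᵢ (i ∷ p) s ρ τ atₛ s-fun
                                  (just-injective (trans (sym (atArgs-⟨⟩ Ls i p ρ atₛ)) atᵢ))
  ... | () , _

  PatternStep : Tm → Sub → Tm → Tm → Set
  PatternStep L σ₁ v v' =
    ∃[ p ] (StepAt R v p v' × NoRedexAbove v p × v ⇉ L ⟨ σ₁ ⟩ × ∃[ s ] (L at p ≡ just s × IsFun s))

  ArgsPatternStep : ∀ {n} → Vec Tm n → Sub → Vec Tm n → Vec Tm n → Set
  ArgsPatternStep Ls σ₁ us us' =
    ∃[ i ] ∃[ p ] (StepAtArgs us i p us' × NoRedexAboveArgs us i p × us ⇉ᵥ substArgs Ls σ₁ ×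
                   ∃[ s ] (atArgs Ls i p ≡ just s × IsFun s))

  patternStep-here : ∀ {n L} {Ls : Vec Tm n} {σ₁ v v' ts} → PatternStep L σ₁ v v' → ts ⇉ᵥ substArgs Ls σ₁ →
                     ArgsPatternStep (L ∷ Ls) σ₁ (v ∷ ts) (v' ∷ ts)
  patternStep-here (p , st , noneAbove , v⇉ , s , atₛ , s-fun) ts⇉ =
    0 , p , stepAtArgs-here st , noneAbove , v⇉ ∷ ts⇉ , s , atₛ , s-fun

  patternStep-there : ∀ {n L} {Ls : Vec Tm n} {σ₁ t ts ts'} → ArgsPatternStep Ls σ₁ ts ts' → t ⇉ L ⟨ σ₁ ⟩ →
                      ArgsPatternStep (L ∷ Ls) σ₁ (t ∷ ts) (t ∷ ts')
  patternStep-there (i , p , st , noneAbove , ts⇉ , s , atₛ , s-fun) t⇉ =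
    suc i , p , stepAtArgs-there st , noneAbove , t⇉ ∷ ts⇉ , s , atₛ , s-fun

  patternStep-fun : ∀ {l₀ r₀} → R l₀ r₀ → ∀ o {n} {g : F n} {Ls} → l₀ at o ≡ just (fun g Ls) → ∀ {σ₁ us us'} →
                    ArgsPatternStep Ls σ₁ us us' → PatternStep (fun g Ls) σ₁ (fun g us) (fun g us')
  patternStep-fun lr₀ o {g = g} at≡ {σ₁} (i , p , st , noneAbove , us⇉ , s , atₛ , s-fun) =
    i ∷ p , stepAt-fun g st ,
    noRedexAbove-fun g noneAbove (no-root-redex lr₀ o at≡ σ₁ us⇉ atₛ s-fun (stepAtArgs⇒redexAtArgs st)) ,
    ⇉-fun g us⇉ , s , atₛ , s-fun

  ReachesPattern : Sub → Tm → Tm → Set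
  ReachesPattern σ₁ t L = ∃[ σ₀ ] (Star (PatternStep L σ₁) t (L ⟨ σ₀ ⟩) × σ₀ ⇉ˢ σ₁)

  reachesPattern⇒⇉ : ∀ {σ₁ t L} → ReachesPattern σ₁ t L → t ⇉ L ⟨ σ₁ ⟩
  reachesPattern⇒⇉ {L = L} (σ₀ , ε , σ₀⇉σ₁)                        = ⇉-⟨⟩ L σ₀⇉σ₁
  reachesPattern⇒⇉         (σ₀ , (_ , _ , _ , t⇉ , _) ◅ _ , σ₀⇉σ₁) = t⇉

  reachesPatterns⇒⇉ᵥ : ∀ {σ₁ n} {ts Ls : Vec Tm n} → Pointwise (ReachesPattern σ₁) ts Ls → ts ⇉ᵥ substArgs Ls σ₁
  reachesPatterns⇒⇉ᵥ []         = []
  reachesPatterns⇒⇉ᵥ (r ∷ rs) = reachesPattern⇒⇉ r ∷ reachesPatterns⇒⇉ᵥ rs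

  reachesPatterns-combine : ∀ {σ₁ n} {ts Ls : Vec Tm n} → Pointwise (ReachesPattern σ₁) ts Ls →
    ∃[ ρs ] (Star (ArgsPatternStep Ls σ₁) ts (substEach Ls ρs) × All (_⇉ˢ σ₁) ρs)
  reachesPatterns-combine [] = [] , ε , []
  reachesPatterns-combine {ts = t ∷ ts} {L ∷ Ls} ((σ₀ , t→Lσ₀ , σ₀⇉σ₁) ∷ rs) with reachesPatterns-combine rs
  ... | ρs , ts→Lsρs , ρs⇉σ₁ =
    σ₀ ∷ ρs ,
    gmap (_∷ ts) (λ st → patternStep-here st (reachesPatterns⇒⇉ᵥ rs)) t→Lσ₀ ◅◅
    gmap (L ⟨ σ₀ ⟩ ∷_) (λ st → patternStep-there st (⇉-⟨⟩ L σ₀⇉σ₁)) ts→Lsρs ,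
    σ₀⇉σ₁ ∷ ρs⇉σ₁

  reaches-fun-pattern : ∀ {l₀ r₀} → R l₀ r₀ → ∀ o {n} {g : F n} {Ls : Vec Tm n} → l₀ at o ≡ just (fun g Ls) →
                        ∀ (σ₁ : Sub) {ts} → Pointwise (ReachesPattern σ₁) ts Ls → ReachesPattern σ₁ (fun g ts) (fun g Ls)
  reaches-fun-pattern lr o {g = g} {Ls} at≡ σ₁ rs with reachesPatterns-combine rs
  ... | ρs , ts→Lsρs , ρs⇉σ₁ =
    merge Ls ρs σ₁ ,
    subst (Star (PatternStep (fun g Ls) σ₁) (fun g _))
          (cong (fun g) (sym (merge-correct Ls ρs σ₁ (linear-args lr o at≡))))
          (gmap (fun g) (patternStep-fun lr o at≡) ts→Lsρs) ,
    merge-preserves (λ x t → t ⇉ σ₁ x) Ls ρs σ₁ (⇉ˢ-refl σ₁) ρs⇉σ₁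

  reaches-var-pattern : ∀ y (σ₁ : Sub) {t} → t ⇉ σ₁ y → ReachesPattern σ₁ t (var y)
  reaches-var-pattern y σ₁ {t} t⇉ = σ₁ [ y ↦ t ] , subst (Star _ t) (sym (↦-self σ₁ y t)) ε , ↦⇉σ₁
    where
    ↦⇉σ₁ : σ₁ [ y ↦ t ] ⇉ˢ σ₁
    ↦⇉σ₁ x with x ≟ y
    ... | yes refl = t⇉
    ... | no _     = ⇉-refl (σ₁ x)

  SubtermOf : Tm → Tm → Set
  SubtermOf l L = ∃[ o ] (l at o ≡ just L)

  subtermOf-args : ∀ {l} o {n} {g : F n} {Ls : Vec Tm n} → l at o ≡ just (fun g Ls) → All (SubtermOf l) Ls
  subtermOf-args {l} o at≡ = all-args _ _ (λ k atₖ → o ++ k ∷ [] , trans (at-++ l o (k ∷ []) at≡) atₖ)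

  -- The second pair of lemmas handles the matcher r σ of a
  -- root step of t ⇉ L σ₁, where the multistep is given only by σ ⇉ˢ σ'.
  mutual
    reaches-pattern : ∀ {l₀ r₀} → R l₀ r₀ → ∀ o L → l₀ at o ≡ just L → ∀ (σ₁ : Sub) {t u} →
                      t ⇉ u → u ≡ L ⟨ σ₁ ⟩ → ReachesPattern σ₁ t L
    reaches-pattern lr o (var y)    _   σ₁ t⇉u eq = reaches-var-pattern y σ₁ (subst (_ ⇉_) eq t⇉u)
    reaches-pattern lr o (fun g Ls) at≡ σ₁ (⇉-var x) ()
    reaches-pattern lr o (fun g Ls) at≡ σ₁ (⇉-fun f ts⇉us) eq with fun-injective eq
    ... | refl , refl , us≡ =
      reaches-fun-pattern lr o at≡ σ₁ (reaches-patterns lr Ls (subtermOf-args o at≡) σ₁ ts⇉us us≡)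
    reaches-pattern lr o (fun g Ls) at≡ σ₁ (⇉-root {r = r} σ σ' lr' σ⇉σ' refl u≡) eq
      with reaches-pattern-⟨⟩ lr o (fun g Ls) at≡ σ₁ r σ⇉σ' (trans (sym u≡) eq)
    ... | σ₀ , t→Lσ₀ , σ₀⇉σ₁ =
      σ₀ ,
      ([] , root-stepAt σ lr' , noRedexAbove-[] _ , ⇉-root σ σ' lr' σ⇉σ' refl (trans (sym eq) u≡) , fun g Ls , refl , tt)
        ◅ t→Lσ₀ ,
      σ₀⇉σ₁

    reaches-patterns : ∀ {l₀ r₀} → R l₀ r₀ → ∀ {n} (Ls : Vec Tm n) → All (SubtermOf l₀) Ls → ∀ (σ₁ : Sub) {ts us} →
                       ts ⇉ᵥ us → us ≡ substArgs Ls σ₁ → Pointwise (ReachesPattern σ₁) ts Ls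
    reaches-patterns lr []       []                 σ₁ []              _  = []
    reaches-patterns lr (L ∷ Ls) ((o , at≡) ∷ subs) σ₁ (t⇉u ∷ ts⇉us) eq =
      reaches-pattern lr o L at≡ σ₁ t⇉u (∷-injectiveˡ eq) ∷ reaches-patterns lr Ls subs σ₁ ts⇉us (∷-injectiveʳ eq)

    reaches-pattern-⟨⟩ : ∀ {l₀ r₀} → R l₀ r₀ → ∀ o L → l₀ at o ≡ just L → ∀ (σ₁ : Sub) (r : Tm) {σ σ' : Sub} →
                         σ ⇉ˢ σ' → r ⟨ σ' ⟩ ≡ L ⟨ σ₁ ⟩ → ReachesPattern σ₁ (r ⟨ σ ⟩) L
    reaches-pattern-⟨⟩ lr o (var y) _ σ₁ r σ⇉σ' eq =
      reaches-var-pattern y σ₁ (subst (_ ⇉_) eq (⇉-⟨⟩ r σ⇉σ'))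
    reaches-pattern-⟨⟩ lr o (fun g Ls) at≡ σ₁ (var x) σ⇉σ' eq = reaches-pattern lr o (fun g Ls) at≡ σ₁ (σ⇉σ' x) eq
    reaches-pattern-⟨⟩ lr o (fun g Ls) at≡ σ₁ (fun f rs) σ⇉σ' eq with fun-injective eq
    ... | refl , refl , rs≡ =
      reaches-fun-pattern lr o at≡ σ₁ (reaches-patterns-⟨⟩ lr Ls (subtermOf-args o at≡) σ₁ rs σ⇉σ' rs≡)

    reaches-patterns-⟨⟩ : ∀ {l₀ r₀} → R l₀ r₀ → ∀ {n} (Ls : Vec Tm n) → All (SubtermOf l₀) Ls → ∀ (σ₁ : Sub)
                          (rs : Vec Tm n) {σ σ' : Sub} → σ ⇉ˢ σ' → substArgs rs σ' ≡ substArgs Ls σ₁ →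
                          Pointwise (ReachesPattern σ₁) (substArgs rs σ) Ls
    reaches-patterns-⟨⟩ lr []       []                 σ₁ []       σ⇉σ' _  = []
    reaches-patterns-⟨⟩ lr (L ∷ Ls) ((o , at≡) ∷ subs) σ₁ (r ∷ rs) σ⇉σ' eq =
      reaches-pattern-⟨⟩ lr o L at≡ σ₁ r σ⇉σ' (∷-injectiveˡ eq) ∷
      reaches-patterns-⟨⟩ lr Ls subs σ₁ rs σ⇉σ' (∷-injectiveʳ eq)

  OutermostToward : Tm → Tm → Tm → Set
  OutermostToward t₁ v v' = OutermostStep R v v' × v ⇉ t₁

  ArgsOutermostToward : ∀ {n} → Vec Tm n → Vec Tm n → Vec Tm n → Set
  ArgsOutermostToward ts₁ us us' = ArgsOutermostStep us us' × us ⇉ᵥ ts₁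

  patternStep⇒toward : ∀ {L σ₁ v v'} → PatternStep L σ₁ v v' → OutermostToward (L ⟨ σ₁ ⟩) v v'
  patternStep⇒toward (p , st , noneAbove , v⇉ , _) = (p , st , noneAbove) , v⇉

  Anticipates : Tm → Tm → Set
  Anticipates t t₁ = ∀ {t₂} → OutermostStep R t₁ t₂ → ∃[ t₀ ] (Star (OutermostToward t₁) t t₀ × t₀ ⇉ t₂)

  AnticipatesArgs : ∀ {n} → Vec Tm n → Vec Tm n → Set
  AnticipatesArgs = Pointwise (λ t t₁ → t ⇉ t₁ × Anticipates t t₁)

  anticipatesArgs⇒⇉ᵥ : ∀ {n} {ts ts₁ : Vec Tm n} → AnticipatesArgs ts ts₁ → ts ⇉ᵥ ts₁
  anticipatesArgs⇒⇉ᵥ []              = []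
  anticipatesArgs⇒⇉ᵥ ((t⇉ , _) ∷ as) = t⇉ ∷ anticipatesArgs⇒⇉ᵥ as

  anticipate-argsStep : ∀ {n} {ts ts₁ : Vec Tm n} → AnticipatesArgs ts ts₁ → ∀ {i q ts₂} →
                        StepAtArgs ts₁ i q ts₂ → NoRedexAboveArgs ts₁ i q →
                        ∃[ ts₀ ] (Star (ArgsOutermostToward ts₁) ts ts₀ × ts₀ ⇉ᵥ ts₂)
  anticipate-argsStep [] (_ , _ , _ , _ , () , _) _
  anticipate-argsStep {ts = t ∷ ts} ((_ , anticipates) ∷ as) {zero} {q} (l , r , σ , lr , at≡ , refl) noneAbove
    with anticipates (q , (l , r , σ , lr , at≡ , refl) , noneAbove)
  ... | t₀ , t→t₀ , t₀⇉ =
    t₀ ∷ ts ,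
    gmap (_∷ ts) (λ { (o , v⇉) → argsOutermost-here o , v⇉ ∷ anticipatesArgs⇒⇉ᵥ as }) t→t₀ ,
    t₀⇉ ∷ anticipatesArgs⇒⇉ᵥ as
  anticipate-argsStep {ts = t ∷ ts} ((t⇉ , _) ∷ as) {suc i} (l , r , σ , lr , at≡ , refl) noneAbove
    with anticipate-argsStep as (l , r , σ , lr , at≡ , refl) noneAbove
  ... | ts₀ , ts→ts₀ , ts₀⇉ =
    t ∷ ts₀ , gmap (t ∷_) (λ { (o , vs⇉) → argsOutermost-there o , t⇉ ∷ vs⇉ }) ts→ts₀ , t⇉ ∷ ts₀⇉

  -- An outermost root step of fun g ts₁ is reached from fun g ts via the redex pattern;
  -- a step below the root is anticipated in the arguments, and it stays outermost since
  -- a root redex of fun g us would persist to fun g ts₁.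
  anticipate-fun : ∀ {n} (g : F n) {ts ts₁} → AnticipatesArgs ts ts₁ → Anticipates (fun g ts) (fun g ts₁)
  anticipate-fun g {ts} args ([] , (l , r , σ₁ , lr , at≡ , refl) , _)
    with reaches-pattern lr [] l refl σ₁ (⇉-fun g (anticipatesArgs⇒⇉ᵥ args)) (just-injective at≡)
  ... | σ₀ , t→lσ₀ , σ₀⇉σ₁ =
    r ⟨ σ₀ ⟩ ,
    subst (λ t₁ → Star (OutermostToward t₁) (fun g ts) (r ⟨ σ₀ ⟩)) (sym (just-injective at≡))
          (map patternStep⇒toward t→lσ₀ ◅◅ (root-outermost σ₀ lr , ⇉-⟨⟩ l σ₀⇉σ₁) ◅ ε) ,
    ⇉-⟨⟩ r σ₀⇉σ₁
  anticipate-fun g {ts₁ = ts₁} args (i ∷ q , (l , r , σ , lr , at≡ , refl) , noneAbove)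
    with anticipate-argsStep args (l , r , σ , lr , at≡ , refl)
                             (λ q' q'<q → noneAbove (i ∷ q') (properPrefix-∷ {F = F} q'<q))
  ... | ts₀ , ts→ts₀ , ts₀⇉ = fun g ts₀ , gmap (fun g) toward-fun ts→ts₀ , ⇉-fun g ts₀⇉
    where
    toward-fun : ∀ {us us'} → ArgsOutermostToward ts₁ us us' → OutermostToward (fun g ts₁) (fun g us) (fun g us')
    toward-fun ((_ , _ , st , noneAbove') , us⇉) =
      outermost-fun g st noneAbove' (λ redex → noneAbove [] (properPrefix-[] {F = F}) (rootRedex-persists g us⇉ redex)) ,
      ⇉-fun g us⇉

  mutual
    anticipate : ∀ {t t₁} → t ⇉ t₁ → Anticipates t t₁
    anticipate (⇉-var x)       (p , st , _) = var x , ε , step⇒⇉ (p , st)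
    anticipate (⇉-fun f ts⇉us) o            = anticipate-fun f (anticipateᵥ ts⇉us) o
    anticipate (⇉-root {r = r} σ σ' lr σ⇉σ' refl refl) o with anticipate-⟨⟩ r σ⇉σ' o
    ... | t₀ , t→t₀ , t₀⇉ = t₀ , (root-outermost σ lr , ⇉-root σ σ' lr σ⇉σ' refl refl) ◅ t→t₀ , t₀⇉

    anticipate-⟨⟩ : ∀ (r : Tm) {σ σ' : Sub} → σ ⇉ˢ σ' → Anticipates (r ⟨ σ ⟩) (r ⟨ σ' ⟩)
    anticipate-⟨⟩ (var x)    σ⇉σ' = anticipate (σ⇉σ' x)
    anticipate-⟨⟩ (fun g rs) σ⇉σ' = anticipate-fun g (anticipateᵥ-⟨⟩ rs σ⇉σ')

    anticipateᵥ : ∀ {n} {ts ts₁ : Vec Tm n} → ts ⇉ᵥ ts₁ → AnticipatesArgs ts ts₁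
    anticipateᵥ []            = []
    anticipateᵥ (t⇉ ∷ ts⇉) = (t⇉ , anticipate t⇉) ∷ anticipateᵥ ts⇉

    anticipateᵥ-⟨⟩ : ∀ {n} (rs : Vec Tm n) {σ σ' : Sub} → σ ⇉ˢ σ' →
                     AnticipatesArgs (substArgs rs σ) (substArgs rs σ')
    anticipateᵥ-⟨⟩ []       σ⇉σ' = []
    anticipateᵥ-⟨⟩ (r ∷ rs) σ⇉σ' = (⇉-⟨⟩ r σ⇉σ' , anticipate-⟨⟩ r σ⇉σ') ∷ anticipateᵥ-⟨⟩ rs σ⇉σ'

  OutermostFirst : Tm → Tm → Set
  OutermostFirst t s = ∃[ t' ] (Star (OutermostStep R) t t' × Star NonRootStep t' s)

  mutual
    ⇉-outermostFirst : ∀ {t t₁} → t ⇉ t₁ → OutermostFirst t t₁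
    ⇉-outermostFirst (⇉-var x)       = var x , ε , ε
    ⇉-outermostFirst (⇉-fun f ts⇉us) = fun f _ , ε , gmap (fun f) (nonRootStep-fun f) (⇉ᵥ⇒star ts⇉us)
    ⇉-outermostFirst (⇉-root {r = r} σ σ' lr σ⇉σ' refl refl) with ⇉-outermostFirst-⟨⟩ r σ⇉σ'
    ... | t' , outer , below = t' , root-outermost σ lr ◅ outer , below

    ⇉-outermostFirst-⟨⟩ : ∀ (r : Tm) {σ σ' : Sub} → σ ⇉ˢ σ' → OutermostFirst (r ⟨ σ ⟩) (r ⟨ σ' ⟩)
    ⇉-outermostFirst-⟨⟩ (var x)    σ⇉σ' = ⇉-outermostFirst (σ⇉σ' x)
    ⇉-outermostFirst-⟨⟩ (fun g rs) σ⇉σ' =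
      fun g _ , ε , gmap (fun g) (nonRootStep-fun g) (⇉ᵥ⇒star (⇉ᵥ-substArgs rs σ⇉σ'))

  ⇉-outermost⋆-first : ∀ {t t₁ t₂} → t ⇉ t₁ → Star (OutermostStep R) t₁ t₂ → OutermostFirst t t₂
  ⇉-outermost⋆-first t⇉ ε = ⇉-outermostFirst t⇉
  ⇉-outermost⋆-first t⇉ (o ◅ os) with anticipate t⇉ o
  ... | t₀ , t→t₀ , t₀⇉ with ⇉-outermost⋆-first t₀⇉ os
  ... | t' , outer , below = t' , map proj₁ t→t₀ ◅◅ outer , below

  outermost-first : ∀ {t s} → Star (Step R) t s → OutermostFirst t s
  outermost-first ε = _ , ε , ε
  outermost-first (st ◅ rest) with outermost-first rest
  ... | _ , outer , below with ⇉-outermost⋆-first (step⇒⇉ st) outer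
  ... | t' , outer' , below' = t' , outer' , below' ◅◅ below

  nonRootSteps-fun : ∀ {n} {f : F n} {t us} → Star NonRootStep t (fun f us) → ∃[ ts ] (t ≡ fun f ts)
  nonRootSteps-fun ε = _ , refl
  nonRootSteps-fun {t = var x}    ((_ , _ , _ , _ , _ , _ , () , _) ◅ _)
  nonRootSteps-fun {t = fun g ts} ((_ , _ , _ , _ , _ , _ , _ , refl) ◅ rest) with nonRootSteps-fun rest
  ... | _ , eq with fun-injective eq
  ... | refl , refl , _ = ts , refl

  outermost-to-fun : ∀ {n} (f : F n) {t us} → Star (Step R) t (fun f us) →
                     ∃[ us' ] (Star (OutermostStep R) t (fun f us') × Star (Step R) (fun f us') (fun f us))
  outermost-to-fun f t→fus with outermost-first t→fus
  ... | _ , outer , below with nonRootSteps-fun below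
  ... | us' , refl = us' , outer , map nonRootStep⇒step below

lemma11 : {F : ℕ → Set} (R : Rules F) (colon : F 2) →
          IsTRS R → Orthogonal R →
          ∀ {t u tu : Term F} →
          Star (Step R) t (cons colon u tu) →
          ∃[ u' ] ∃[ tu' ]
            (Star (OutermostStep R) t (cons colon u' tu') ×
             Star (Step R) (cons colon u' tu') (cons colon u tu))
lemma11 R colon _ (left-linear , non-overlapping) t→u:tu
  with Reordering.outermost-to-fun R left-linear non-overlapping colon t→u:tu
... | u' ∷ tu' ∷ [] , outer , rest = u' , tu' , outer , rest
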